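{- Let $G$ be a graph of order $n$ that contains a cycle, and suppose $PC(G)=n$. Then the girth of $G$ satisfies $g(G)\le 4$.
   Context: The girth $g(G)$ of a graph containing a cycle is the length of a shortest cycle of $G$. A paired dominating set of $G$ is a dominating set $S$ such that $G[S]$ has a perfect matching. Two disjoint sets form a paired coalition if neither is a paired dominating set but their union is. A $pc$-partition of $G$ is a partition of $V(G)$ into nonempty sets, none a paired dominating set, each forming a paired coalition with some other set of the partition. $PC(G)$ is the maximum number of sets in a $pc$-partition. -}

module Defs where

open import Data.Nat using (ℕ; zero; suc; _≤_; _+_)
open import Data.Fin using (Fin; zero; suc; toℕ)
open import Data.Product using (Σ; ∃; ∃-syntax; Σ-syntax; _×_; _,_)
open import Data.Sum using (_⊎_)
open import Relation.Binary.PropositionalEquality using (_≡_; _≢_)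
open import Relation.Nullary using (¬_)
open import Function.Definitions using (Injective; Surjective)

record Graph (n : ℕ) : Set₁ where
  field
    Adj   : Fin n → Fin n → Set
    sym   : ∀ {u v} → Adj u v → Adj v u
    irrefl : ∀ {v} → ¬ Adj v v
open Graph public

VSet : ℕ → Set₁
VSet n = Fin n → Set

_∪_ : ∀ {n} → VSet n → VSet n → VSet n
(A ∪ B) v = A v ⊎ B v

module _ {n : ℕ} (G : Graph n) where

  Dominating : VSet n → Set
  Dominating S = ∀ v → S v ⊎ (∃[ u ] (S u × Adj G v u))

  -- G[S] has a perfect matching: a partner function m on S with m v ∈ S,
  -- v m v an edge, and m (m v) ≡ v (so the edges {v, m v} are pairwise
  -- disjoint and cover S).
  HasPerfectMatching : VSet n → Set
  HasPerfectMatching S =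
    Σ[ m ∈ (Fin n → Fin n) ] (∀ v → S v → S (m v) × Adj G v (m v) × m (m v) ≡ v)

  PairedDominating : VSet n → Set
  PairedDominating S = Dominating S × HasPerfectMatching S

  PairedCoalition : VSet n → VSet n → Set
  PairedCoalition A B =
    ¬ PairedDominating A × ¬ PairedDominating B × PairedDominating (A ∪ B)

  -- A partition of V(G) into k nonempty sets, given by the map sending a
  -- vertex to the index of its part; part i = { v | f v ≡ i }.
  Part : ∀ {k} → (Fin n → Fin k) → Fin k → VSet n
  Part f i v = f v ≡ i

  PCPartition : (k : ℕ) → (Fin n → Fin k) → Set
  PCPartition k f =
    Surjective _≡_ _≡_ f
    × (∀ i → ¬ PairedDominating (Part f i))
    × (∀ i → ∃[ j ] (j ≢ i × PairedCoalition (Part f i) (Part f j)))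

  IsPC : ℕ → Set
  IsPC p = (∃[ f ] PCPartition p f)
         × (∀ k (f : Fin n → Fin k) → PCPartition k f → k ≤ p)

  -- A cycle of length k ≥ 3: k distinct vertices c 0, …, c (k-1) with
  -- c i adjacent to c (i+1 mod k).
  next : ∀ {k} → Fin k → Fin k
  next {suc k} i with toℕ i Data.Nat.≟ k
  ... | Relation.Nullary.yes _ = zero
  ... | Relation.Nullary.no ne = Data.Fin.fromℕ< (Data.Nat.s≤s (Data.Nat.Properties.≤∧≢⇒< (Data.Fin.Properties.toℕ≤pred[n] i) ne))
    where import Data.Fin.Properties
          import Data.Nat.Properties

  Cycle : (k : ℕ) → (Fin k → Fin n) → Set
  Cycle k c = 3 ≤ k × Injective _≡_ _≡_ c × (∀ i → Adj G (c i) (c (next i)))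

  HasCycle : Set
  HasCycle = ∃[ k ] ∃[ c ] Cycle k c

  IsGirth : ℕ → Set
  IsGirth g = (∃[ c ] Cycle g c) × (∀ k c → Cycle k c → g ≤ k)

{-# OPTIONS --safe #-}
module Submission where

open import Defs renaming (sym to Adj-sym)
open import Data.Nat using (ℕ; zero; suc; _≤_; s≤s)
open import Data.Nat.Properties using (≤-refl; ≤-trans; n≤1+n; 1+n≰n)
open import Data.Fin using (Fin; zero; suc; punchOut)
open import Data.Fin.Properties using (_≟_; punchOut-injective; injective⇒≤)
open import Data.Vec using (_∷_; []; lookup)
open import Data.Vec.Relation.Unary.All using (_∷_; [])
open import Data.Vec.Relation.Unary.AllPairs using (_∷_; [])
open import Data.Vec.Relation.Unary.Unique.Propositional using (Unique)
open import Data.Vec.Relation.Unary.Unique.Propositional.Properties using (lookup-injective; take⁺; drop⁺; tabulate⁺)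
open import Data.Product using (∃-syntax; _×_; _,_; proj₁; proj₂)
open import Data.Sum using (_⊎_; inj₁; inj₂)
open import Function.Definitions using (Injective; Surjective)
open import Relation.Binary.PropositionalEquality using (_≡_; _≢_; ≢-sym; refl; sym; trans; cong; subst; module ≡-Reasoning)
open import Relation.Nullary.Negation using (¬_; contradiction)
open import Relation.Nullary.Decidable using (yes; no; decidable-stable)
open import Relation.Unary using (_⊆_)

-- A pc-partition with n parts consists of singletons, and the
-- coalition partner {y} of a part {v} makes vy an edge whose two closed
-- neighbourhoods cover V(G). Given a path x₁x₂x₃x₄ and such an edge x₁y,
-- the vertex x₃ is adjacent to x₁ or y: the first closes a triangle, the
-- second the 4-cycle x₂x₁yx₃ unless y = x₂, in which case domination of
-- x₄ closes x₁x₂x₃x₄ or the triangle x₂x₃x₄.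

injective⇒¬misses : ∀ {n} {g : Fin n → Fin n} → Injective _≡_ _≡_ g →
                    ∀ c → ¬ (∀ x → c ≢ g x)
injective⇒¬misses {suc n} {g} g-inj c misses = 1+n≰n (injective⇒≤ punchOut∘g-inj)
  where
  punchOut∘g-inj : Injective _≡_ _≡_ (λ x → punchOut (misses x))
  punchOut∘g-inj eq = g-inj (punchOut-injective (misses _) (misses _) eq)

surjective⇒injective : ∀ {n} {f : Fin n → Fin n} → Surjective _≡_ _≡_ f →
                       Injective _≡_ _≡_ f
surjective⇒injective {n} {f} surj {a} {b} fa≡fb = begin
  a             ≡⟨ sym (section-fixes a) ⟩
  section (f a) ≡⟨ cong section fa≡fb ⟩
  section (f b) ≡⟨ section-fixes b ⟩
  b             ∎
  where
  open ≡-Reasoning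
  section : Fin n → Fin n
  section i = proj₁ (surj i)
  f∘section : ∀ i → f (section i) ≡ i
  f∘section i = proj₂ (surj i) refl
  section-inj : Injective _≡_ _≡_ section
  section-inj {i} {j} eq = trans (sym (f∘section i)) (trans (cong f eq) (f∘section j))
  -- the only possible preimage of x under section is f x
  section-fixes : ∀ x → section (f x) ≡ x
  section-fixes x = decidable-stable (section (f x) ≟ x) λ ¬fixed →
    injective⇒¬misses section-inj x λ i x≡si →
      ¬fixed (subst (λ z → section (f z) ≡ z) (sym x≡si) (cong section (f∘section i)))

module _ {n : ℕ} (G : Graph n) where

  pair : Fin n → Fin n → VSet n
  pair v y w = w ≡ v ⊎ w ≡ y

  N[_] : Fin n → VSet n
  N[ v ] w = w ≡ v ⊎ Adj G w v

  DominatingEdge : Fin n → Fin n → Set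
  DominatingEdge v y = Adj G v y × (∀ w → N[ v ] w ⊎ N[ y ] w)

  pairedDominating⇒dominatingEdge : ∀ {S v y} → S ⊆ pair v y → S v →
                                    PairedDominating G S → DominatingEdge v y
  pairedDominating⇒dominatingEdge {S} {v} {y} S⊆vy v∈S (dom , m , matched) = v~y , covered
    where
    v~y : Adj G v y
    v~y with matched v v∈S
    ... | mv∈S , v~mv , _ with S⊆vy mv∈S
    ...   | inj₁ mv≡v = contradiction (subst (Adj G v) mv≡v v~mv) (irrefl G)
    ...   | inj₂ mv≡y = subst (Adj G v) mv≡y v~mv
    covered : ∀ w → N[ v ] w ⊎ N[ y ] w
    covered w with dom w
    ... | inj₁ w∈S with S⊆vy w∈S
    ...   | inj₁ w≡v = inj₁ (inj₁ w≡v)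
    ...   | inj₂ w≡y = inj₂ (inj₁ w≡y)
    covered w | inj₂ (u , u∈S , w~u) with S⊆vy u∈S
    ...   | inj₁ refl = inj₁ (inj₂ w~u)
    ...   | inj₂ refl = inj₂ (inj₂ w~u)

  pcPartition⇒dominatingEdges : ∀ {f} → PCPartition G n f → ∀ v → ∃[ y ] DominatingEdge v y
  pcPartition⇒dominatingEdges {f} (surj , _ , coalition) v with coalition (f v)
  ... | j , _ , _ , _ , union-pd =
    y , pairedDominating⇒dominatingEdge parts⊆vy (inj₁ refl) union-pd
    where
    y : Fin n
    y = proj₁ (surj j)
    f-inj : Injective _≡_ _≡_ f
    f-inj = surjective⇒injective surj
    parts⊆vy : Part G f (f v) ∪ Part G f j ⊆ pair v y
    parts⊆vy (inj₁ fw≡fv) = inj₁ (f-inj fw≡fv)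
    parts⊆vy (inj₂ fw≡j) = inj₂ (f-inj (trans fw≡j (sym (proj₂ (surj j) refl))))

  ShortCycle : Set
  ShortCycle = ∃[ k ] (k ≤ 4 × ∃[ c ] Cycle G k c)

  triangle : ∀ {a b c} → Unique (a ∷ b ∷ c ∷ []) →
             Adj G a b → Adj G b c → Adj G c a → ShortCycle
  triangle {a} {b} {c} distinct a~b b~c c~a =
    3 , n≤1+n 3 , lookup (a ∷ b ∷ c ∷ []) , ≤-refl , lookup-injective distinct _ _ , edges
    where
    edges : ∀ i → Adj G (lookup (a ∷ b ∷ c ∷ []) i) (lookup (a ∷ b ∷ c ∷ []) (next G i))
    edges zero = a~b
    edges (suc zero) = b~c
    edges (suc (suc zero)) = c~a

  square : ∀ {a b c d} → Unique (a ∷ b ∷ c ∷ d ∷ []) →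
           Adj G a b → Adj G b c → Adj G c d → Adj G d a → ShortCycle
  square {a} {b} {c} {d} distinct a~b b~c c~d d~a =
    4 , ≤-refl , lookup (a ∷ b ∷ c ∷ d ∷ []) , n≤1+n 3 , lookup-injective distinct _ _ , edges
    where
    edges : ∀ i → Adj G (lookup (a ∷ b ∷ c ∷ d ∷ []) i) (lookup (a ∷ b ∷ c ∷ d ∷ []) (next G i))
    edges zero = a~b
    edges (suc zero) = b~c
    edges (suc (suc zero)) = c~d
    edges (suc (suc (suc zero))) = d~a

  adjacent⇒≢ : ∀ {u v} → Adj G u v → u ≢ v
  adjacent⇒≢ u~v refl = irrefl G u~v

  path⇒shortCycle : ∀ {x₁ x₂ x₃ x₄ y} → DominatingEdge x₁ y → Unique (x₁ ∷ x₂ ∷ x₃ ∷ x₄ ∷ []) →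
                    Adj G x₁ x₂ → Adj G x₂ x₃ → Adj G x₃ x₄ → ShortCycle
  path⇒shortCycle {x₁} {x₂} {x₃} {x₄} {y} (x₁~y , covered)
    distinct@((x₁≢x₂ ∷ x₁≢x₃ ∷ x₁≢x₄ ∷ []) ∷ (x₂≢x₃ ∷ x₂≢x₄ ∷ []) ∷ _) x₁~x₂ x₂~x₃ x₃~x₄
    with covered x₃
  ... | inj₁ (inj₁ x₃≡x₁) = contradiction (sym x₃≡x₁) x₁≢x₃
  ... | inj₁ (inj₂ x₃~x₁) = triangle (take⁺ 3 distinct) x₁~x₂ x₂~x₃ x₃~x₁
  ... | inj₂ (inj₁ refl)  = triangle (take⁺ 3 distinct) x₁~x₂ x₂~x₃ (Adj-sym G x₁~y)
  ... | inj₂ (inj₂ x₃~y) with y ≟ x₂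
  ...   | no y≢x₂ = square
          ((≢-sym x₁≢x₂ ∷ ≢-sym y≢x₂ ∷ x₂≢x₃ ∷ []) ∷ (adjacent⇒≢ x₁~y ∷ x₁≢x₃ ∷ [])
            ∷ (adjacent⇒≢ (Adj-sym G x₃~y) ∷ []) ∷ [] ∷ [])
          (Adj-sym G x₁~x₂) x₁~y (Adj-sym G x₃~y) (Adj-sym G x₂~x₃)
  ...   | yes refl with covered x₄
  ...     | inj₁ (inj₁ x₄≡x₁) = contradiction (sym x₄≡x₁) x₁≢x₄
  ...     | inj₁ (inj₂ x₄~x₁) = square distinct x₁~x₂ x₂~x₃ x₃~x₄ x₄~x₁
  ...     | inj₂ (inj₁ x₄≡x₂) = contradiction (sym x₄≡x₂) x₂≢x₄
  ...     | inj₂ (inj₂ x₄~x₂) = triangle (drop⁺ 1 distinct) x₂~x₃ x₃~x₄ x₄~x₂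

  cycle⇒shortCycle : (∀ v → ∃[ y ] DominatingEdge v y) → ∀ {k c} → Cycle G k c → ShortCycle
  cycle⇒shortCycle _ {1} (s≤s () , _)
  cycle⇒shortCycle _ {2} (s≤s (s≤s ()) , _)
  cycle⇒shortCycle _ {3} {c} cyc = 3 , n≤1+n 3 , c , cyc
  cycle⇒shortCycle dominatingEdge {suc (suc (suc (suc _)))} {c} (_ , c-inj , edges) =
    path⇒shortCycle (proj₂ (dominatingEdge (c zero))) (take⁺ 4 (tabulate⁺ c-inj))
      (edges zero) (edges (suc zero)) (edges (suc (suc zero)))

-- The hypothesis HasCycle G is implied by IsGirth G g.
mainTheorem13 : (n : ℕ) (G : Graph n) → HasCycle G → IsPC G n →
    (g : ℕ) → IsGirth G g → g ≤ 4
mainTheorem13 n G _ ((_ , pc) , _) g ((_ , girth-cycle) , girth-minimal)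
  with k , k≤4 , c , k-cycle ← cycle⇒shortCycle G (pcPartition⇒dominatingEdges G pc) girth-cycle
  = ≤-trans (girth-minimal k c k-cycle) k≤4
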